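{- Let $A$ be a commutative ring with identity and $HA$ the ring of Hurwitz series over $A$. Let $n\in\mathbb{N}^+$ be fixed, $z_0,\dots,z_{n-1}\in HA$ and $z=\mathrm{intl}(z_0,\dots,z_{n-1})$. Then for all $k\in\mathbb{N}$, $$\langle k\rangle\int z=\int^{k+1}\mathrm{intl}\Big(C^{k+1}_{k,n}\boxdot z_0,\ \dots,\ C^{i+k+1}_{k,n}\boxdot z_i,\ \dots,\ C^{n+k}_{k,n}\boxdot z_{n-1}\Big).$$
   Context: $HA$ is the set of sequences $f=(f(0),f(1),\dots)$ with entries in $A$, with componentwise addition and product $(fg)(m)=\sum_{i=0}^m\binom{m}{i}f(i)g(m-i)$. The integral is $\int f=(0,f(0),f(1),\dots)$ and $\int^m$ its $m$-fold iterate. $\langle k\rangle\in HA$ is given by $\langle k\rangle(i)=\delta_{i,k}$. For fixed $n$, $\widehat{q}=\lfloor q/n\rfloor$, $\overline{q}=q-\widehat{q}n$; the interlacing is $\mathrm{intl}(z_0,\dots,z_{n-1})(q)=z_{\overline{q}}(\widehat{q})$. The Hadamard product is $(f\boxdot g)(p)=f(p)g(p)$. $C^{\ell}_{k,n}\in HA$ is defined by $C^{\ell}_{k,n}(p)=\binom{\ell+pn}{k}$ (with $\binom{a}{b}=0$ if $a<b$). -}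

module Defs where

open import Level using (Level)
open import Algebra.Bundles using (CommutativeRing)
open import Data.Nat using (ℕ; zero; suc; _∸_; NonZero) renaming (_+_ to _+ℕ_; _*_ to _*ℕ_)
open import Data.Nat.Combinatorics using (_C_)
open import Data.Nat.DivMod using (_div_; _mod_)
open import Data.Fin using (Fin; toℕ)
open import Relation.Nullary using (yes; no)
import Data.Nat as ℕ

module Hurwitz {c ℓ : Level} (R : CommutativeRing c ℓ) where
  open CommutativeRing R

  HA : Set c
  HA = ℕ → Carrier

  _≈H_ : HA → HA → Set ℓ
  f ≈H g = ∀ p → f p ≈ g p

  _·_ : ℕ → Carrier → Carrier
  zero · x = 0#
  suc m · x = x + (m · x)

  sumTo : ℕ → (ℕ → Carrier) → Carrier
  sumTo zero f = f 0
  sumTo (suc m) f = sumTo m f + f (suc m)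

  _⊛_ : HA → HA → HA
  (f ⊛ g) m = sumTo m (λ i → (m C i) · (f i * g (m ∸ i)))

  ∫ : HA → HA
  ∫ f zero = 0#
  ∫ f (suc m) = f m

  ∫^ : ℕ → HA → HA
  ∫^ zero f = f
  ∫^ (suc m) f = ∫ (∫^ m f)

  ⟨_⟩ : ℕ → HA
  ⟨ k ⟩ i with i ℕ.≟ k
  ... | yes _ = 1#
  ... | no _ = 0#

  intl : (n : ℕ) .{{_ : NonZero n}} → (Fin n → HA) → HA
  intl n z q = z (q mod n) (q div n)

  _⊡_ : HA → HA → HA
  (f ⊡ g) p = f p * g p

  Cf : ℕ → ℕ → ℕ → HA
  Cf l k n p = ((l +ℕ p *ℕ n) C k) · 1#

-- Multiplying by ⟨k⟩ is a binomially weighted k-fold shift: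
-- (⟨k⟩ ⊛ f)(m) = C(m,k) f(m − k), since ⟨k⟩ kills every term of the Hurwitz
-- convolution but the one with i = k. For f = ∫ z this vanishes for m ≤ k and
-- equals C(k+1+q, k) z(q) at m = k+1+q, i.e. it is the (k+1)-fold integral of
-- q ↦ C(k+1+q, k) z(q). For z interlaced with period n, writing q = r + p n with
-- r < n shows that this weight is C^{r+k+1}_{k,n}(p), applied to z_r(p).
module Submission where

open import Defs
open import Level using (Level)
open import Algebra.Bundles using (CommutativeRing)
open import Data.Nat
  using (ℕ; zero; suc; NonZero; _+_; _*_; _∸_; _≤_; _<_; _≤′_; ≤′-refl; ≤′-step; _≟_; _≤?_; z≤n; s≤s)
open import Data.Nat.Properties
  using (≤-refl; m≤n⇒m≤1+n; ≤⇒≤′; ≤′⇒≤; <⇒≢; ≰⇒>; m≤n⇒m∸n≡0; m+n∸m≡n; +-suc)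
open import Data.Nat.Combinatorics using (_C_; k>n⇒nCk≡0)
open import Data.Nat.DivMod using (_mod_; _div_; m≡m%n+[m/n]*n)
open import Data.Nat.Tactic.RingSolver using (solve-∀)
open import Data.Fin using (Fin; toℕ)
open import Data.Fin.Properties using (toℕ-fromℕ<)
open import Data.Empty using (⊥-elim)
open import Relation.Binary.PropositionalEquality as ≡ using (_≡_; _≢_)
open import Relation.Nullary using (yes; no)
import Algebra.Properties.Semiring.Mult as SemiringMult
import Relation.Binary.Reasoning.Setoid as SetoidReasoning

toℕ-mod+div*n≡ : ∀ n .{{_ : NonZero n}} q → toℕ (q mod n) + q div n * n ≡ q
toℕ-mod+div*n≡ n q =
  ≡.trans (≡.cong (_+ q div n * n) (toℕ-fromℕ< _)) (≡.sym (m≡m%n+[m/n]*n q n))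

module HurwitzProperties {c ℓ : Level} (R : CommutativeRing c ℓ) where
  open CommutativeRing R hiding (_+_; _*_; zero)
  open CommutativeRing R using () renaming (_+_ to _+ᴿ_; _*_ to _*ᴿ_)
  open Hurwitz R
  open SemiringMult semiring using (_×_; ×-assoc-*; ×-congʳ)
  open SetoidReasoning setoid

  ·≗× : ∀ n x → n · x ≡ n × x
  ·≗× zero    x = ≡.refl
  ·≗× (suc n) x = ≡.cong (x +ᴿ_) (·≗× n x)

  ·≈·1#* : ∀ n x → n · x ≈ (n · 1#) *ᴿ x
  ·≈·1#* n x rewrite ·≗× n x | ·≗× n 1# =
    sym (trans (×-assoc-* n 1# x) (×-congʳ n (*-identityˡ x)))

  ⟨⟩-diag : ∀ k → ⟨ k ⟩ k ≈ 1#
  ⟨⟩-diag k with k ≟ k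
  ... | yes _   = refl
  ... | no  k≢k = ⊥-elim (k≢k ≡.refl)

  ⟨⟩-off : ∀ {k i} → i ≢ k → ⟨ k ⟩ i ≈ 0#
  ⟨⟩-off {k} {i} i≢k with i ≟ k
  ... | yes i≡k = ⊥-elim (i≢k i≡k)
  ... | no  _   = refl

  sumTo-zero : ∀ m {g : ℕ → Carrier} → (∀ i → i ≤ m → g i ≈ 0#) → sumTo m g ≈ 0#
  sumTo-zero zero    g≈0 = g≈0 0 z≤n
  sumTo-zero (suc m) g≈0 =
    trans (+-cong (sumTo-zero m (λ i i≤m → g≈0 i (m≤n⇒m≤1+n i≤m))) (g≈0 (suc m) ≤-refl))
          (+-identityʳ 0#)

  sumTo-single : ∀ {k m} {g : ℕ → Carrier} → k ≤′ m → (∀ i → i ≢ k → g i ≈ 0#) →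
                 sumTo m g ≈ g k
  sumTo-single {zero}  ≤′-refl g≈0 = refl
  sumTo-single {suc k} ≤′-refl g≈0 =
    trans (+-congʳ (sumTo-zero k (λ i i≤k → g≈0 i (<⇒≢ (s≤s i≤k))))) (+-identityˡ _)
  sumTo-single {k} (≤′-step {m} k≤m) g≈0 =
    trans (+-cong (sumTo-single k≤m g≈0)
                  (g≈0 (suc m) (λ 1+m≡k → <⇒≢ (s≤s (≤′⇒≤ k≤m)) (≡.sym 1+m≡k))))
          (+-identityʳ _)

  ·-⟨⟩-*-off : ∀ n {k i} x → i ≢ k → n · (⟨ k ⟩ i *ᴿ x) ≈ 0#
  ·-⟨⟩-*-off n x i≢k = trans (·≈·1#* n _)
    (trans (*-congˡ (trans (*-congʳ (⟨⟩-off i≢k)) (zeroˡ x))) (zeroʳ _))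

  ⟨⟩-⊛ : ∀ k f m → (⟨ k ⟩ ⊛ f) m ≈ ((m C k) · 1#) *ᴿ f (m ∸ k)
  ⟨⟩-⊛ k f m with k ≤? m
  ... | yes k≤m =
    begin
      sumTo m (λ i → (m C i) · (⟨ k ⟩ i *ᴿ f (m ∸ i)))
    ≈⟨ sumTo-single (≤⇒≤′ k≤m) (λ i → ·-⟨⟩-*-off (m C i) {k} {i} (f (m ∸ i))) ⟩
      (m C k) · (⟨ k ⟩ k *ᴿ f (m ∸ k))
    ≈⟨ ·≈·1#* (m C k) _ ⟩
      ((m C k) · 1#) *ᴿ (⟨ k ⟩ k *ᴿ f (m ∸ k))
    ≈⟨ *-congˡ (trans (*-congʳ (⟨⟩-diag k)) (*-identityˡ _)) ⟩
      ((m C k) · 1#) *ᴿ f (m ∸ k)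
    ∎
  ... | no k≰m rewrite k>n⇒nCk≡0 (≰⇒> k≰m) =
    trans (sumTo-zero m λ i i≤m →
             ·-⟨⟩-*-off (m C i) {k} {i} (f (m ∸ i)) λ { ≡.refl → k≰m i≤m })
          (sym (zeroˡ _))

  ≈H-∫^ : ∀ j {f g : HA} → (∀ m → m < j → f m ≈ 0#) → (∀ q → f (j + q) ≈ g q) →
          f ≈H ∫^ j g
  ≈H-∫^ zero    _   f≈g q       = f≈g q
  ≈H-∫^ (suc j) f≈0 _   zero    = f≈0 zero (s≤s z≤n)
  ≈H-∫^ (suc j) f≈0 f≈g (suc m) = ≈H-∫^ j (λ m m<j → f≈0 (suc m) (s≤s m<j)) f≈g m

  ∫^-cong : ∀ j {f g : HA} → f ≈H g → ∫^ j f ≈H ∫^ j g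
  ∫^-cong zero    f≈g m       = f≈g m
  ∫^-cong (suc j) f≈g zero    = refl
  ∫^-cong (suc j) f≈g (suc m) = ∫^-cong j f≈g m

  ⟨⟩-⊛-∫ : ∀ k f → (⟨ k ⟩ ⊛ ∫ f) ≈H ∫^ (suc k) (λ q → (((suc k + q) C k) · 1#) *ᴿ f q)
  ⟨⟩-⊛-∫ k f = ≈H-∫^ (suc k) vanish shift
    where
    vanish : ∀ m → m < suc k → (⟨ k ⟩ ⊛ ∫ f) m ≈ 0#
    vanish m (s≤s m≤k) = trans (⟨⟩-⊛ k (∫ f) m)
      (trans (*-congˡ (reflexive (≡.cong (∫ f) (m≤n⇒m∸n≡0 m≤k)))) (zeroʳ _))
    shift : ∀ q → (⟨ k ⟩ ⊛ ∫ f) (suc k + q) ≈ (((suc k + q) C k) · 1#) *ᴿ f q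
    shift q = trans (⟨⟩-⊛ k (∫ f) (suc k + q))
      (reflexive (≡.cong (λ t → (((suc k + q) C k) · 1#) *ᴿ ∫ f t)
        (≡.trans (≡.cong (_∸ k) (≡.sym (+-suc k q))) (m+n∸m≡n k (suc q)))))

  intl-⊡-Cf : ∀ n .{{_ : NonZero n}} (zs : Fin n → HA) k →
              (λ q → (((suc k + q) C k) · 1#) *ᴿ intl n zs q)
                ≈H intl n (λ i → Cf (toℕ i + k + 1) k n ⊡ zs i)
  intl-⊡-Cf n zs k q =
    reflexive (≡.cong (λ t → ((t C k) · 1#) *ᴿ intl n zs q) (≡.sym index))
    where
    rearrange : ∀ r k s → r + k + 1 + s ≡ suc k + (r + s)
    rearrange = solve-∀
    index : toℕ (q mod n) + k + 1 + q div n * n ≡ suc k + q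
    index = ≡.trans (rearrange (toℕ (q mod n)) k (q div n * n))
                    (≡.cong (suc k +_) (toℕ-mod+div*n≡ n q))

lemma3p7 : ∀ {c ℓ : Level} (R : CommutativeRing c ℓ) (n : ℕ) .{{_ : NonZero n}}
    (zs : Fin n → Hurwitz.HA R) (k : ℕ) →
    let open Hurwitz R in
    (⟨ k ⟩ ⊛ ∫ (intl n zs))
    ≈H ∫^ (suc k) (intl n (λ i → Cf (toℕ i + k + 1) k n ⊡ zs i))
lemma3p7 R n zs k m =
  trans (⟨⟩-⊛-∫ k (intl n zs) m) (∫^-cong (suc k) (intl-⊡-Cf n zs k) m)
  where
  open CommutativeRing R using (trans)
  open Hurwitz R
  open HurwitzProperties R
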